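{- Let $D$ be a vertex-supported effective divisor on a metric graph $\Gamma$. If $f\in R(D)$ and $D+(f)$ is an anchor divisor, then $f$ has at most two linear pieces on each edge of $\Gamma$.
   Context: A metric graph $\Gamma=(V,E)$ is a connected undirected graph (loops and parallel edges allowed) whose edges have positive lengths. A divisor is a finite formal sum $D=\sum_{x\in\Gamma}D(x)\,x$, $D(x)\in\mathbb{Z}$; effective means all $D(x)\ge0$; vertex-supported means $D(x)=0$ for $x\notin V$. A rational function $f$ on $\Gamma$ is continuous, piecewise linear with finitely many pieces and integer slopes on each edge; $\operatorname{ord}_x(f)$ is the sum of outgoing slopes at $x$ over all directions, and $(f)=\sum_x\operatorname{ord}_x(f)\,x$. $R(D)$ is the set of rational functions $f$ with $D+(f)$ effective. A divisor $L$ is an anchor divisor if for each edge of $\Gamma$ there is at most one interior point $x$ of that edge with $L(x)>0$. -}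

module Defs where

open import Level using (Level; suc; zero) renaming (_⊔_ to _⊔ℓ_)
open import Data.Nat using (ℕ) renaming (suc to sucℕ; zero to zeroℕ)
open import Data.Integer as ℤ using (ℤ; +_; -[1+_])
open import Data.Fin using (Fin)
open import Data.List using (List)
open import Data.List.Membership.Propositional using (_∈_)
open import Data.Product using (Σ; ∃; ∃-syntax; _×_; _,_)
open import Data.Sum using (_⊎_)
open import Relation.Nullary using (¬_)
open import Relation.Binary.PropositionalEquality using (_≡_; _≢_)

-- The real numbers, axiomatised as a (Dedekind-)complete ordered field.
-- (agda-stdlib has no reals; any complete ordered field is ℝ up to a
-- unique isomorphism, so quantifying over such records is faithful.)

record RealField : Set₁ where
  infixl 6 _+_
  infixl 7 _*_
  infix  4 _<_ _≤_
  field
    Carrier : Set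
    0# 1#   : Carrier
    _+_ _*_ : Carrier → Carrier → Carrier
    -_      : Carrier → Carrier
    _<_     : Carrier → Carrier → Set
    +-assoc     : ∀ x y z → (x + y) + z ≡ x + (y + z)
    +-comm      : ∀ x y → x + y ≡ y + x
    +-identityˡ : ∀ x → 0# + x ≡ x
    -‿inverseˡ  : ∀ x → (- x) + x ≡ 0#
    *-assoc     : ∀ x y z → (x * y) * z ≡ x * (y * z)
    *-comm      : ∀ x y → x * y ≡ y * x
    *-identityˡ : ∀ x → 1# * x ≡ x
    distribʳ    : ∀ x y z → (x + y) * z ≡ (x * z) + (y * z)
    0≢1         : 0# ≢ 1#
    *-inverse   : ∀ x → x ≢ 0# → ∃[ y ] (y * x ≡ 1#)
    <-irrefl    : ∀ x → ¬ (x < x)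
    <-trans     : ∀ {x y z} → x < y → y < z → x < z
    <-trichotomy : ∀ x y → x < y ⊎ x ≡ y ⊎ y < x
    +-mono-<    : ∀ {x y} z → x < y → x + z < y + z
    *-pos       : ∀ {x y} → 0# < x → 0# < y → 0# < x * y
    sup : (P : Carrier → Set) → ∃[ x ] P x →
          ∃[ b ] (∀ x → P x → x < b ⊎ x ≡ b) →
          ∃[ s ] ((∀ x → P x → x < s ⊎ x ≡ s) ×
                  (∀ b → (∀ x → P x → x < b ⊎ x ≡ b) → s < b ⊎ s ≡ b))

  _≤_ : Carrier → Carrier → Set
  x ≤ y = x < y ⊎ x ≡ y

  _-_ : Carrier → Carrier → Carrier
  x - y = x + (- y)

  fromℕ : ℕ → Carrier
  fromℕ zeroℕ = 0#
  fromℕ (sucℕ k) = 1# + fromℕ k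

  fromℤ : ℤ → Carrier
  fromℤ (+ k) = fromℕ k
  fromℤ -[1+ k ] = - (fromℕ (sucℕ k))

  _·_ : ℤ → Carrier → Carrier
  s · x = fromℤ s * x

module _ (ℝ : RealField) where
  open RealField ℝ

  -- A finite graph with vertex set Fin n, edge set Fin m (loops and
  -- parallel edges allowed); edge e runs from src e to tgt e, and a point
  -- in the interior of e is given by its distance t ∈ (0, len e) from src e.
  record MetricGraph : Set where
    field
      n m  : ℕ
      src tgt : Fin m → Fin n
      len  : Fin m → Carrier
      len-pos : ∀ e → 0# < len e

  module _ (Γ : MetricGraph) where
    open MetricGraph Γ

    data Walk : Fin n → Fin n → Set where
      here  : ∀ v → Walk v v
      fwd   : ∀ e {w} → Walk (tgt e) w → Walk (src e) w
      bwd   : ∀ e {w} → Walk (src e) w → Walk (tgt e) w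

    Connected : Set
    Connected = ∀ u v → Walk u v

    Interior : Fin m → Carrier → Set
    Interior e t = 0# < t × t < len e

    record Divisor : Set where
      field
        atV : Fin n → ℤ
        atE : Fin m → Carrier → ℤ
        finite : ∀ e → ∃[ S ] (∀ t → Interior e t → atE e t ≢ ℤ.0ℤ → t ∈ S)

    Effective : Divisor → Set
    Effective D = (∀ v → ℤ.0ℤ ℤ.≤ Divisor.atV D v)
                × (∀ e t → Interior e t → ℤ.0ℤ ℤ.≤ Divisor.atE D e t)

    VertexSupported : Divisor → Set
    VertexSupported D = ∀ e t → Interior e t → Divisor.atE D e t ≡ ℤ.0ℤ

    -- A function on Γ: a value at every vertex and, for each edge e, a
    -- function of the position t ∈ [0, len e] (values outside are irrelevant).
    record FunΓ : Set where
      field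
        atV : Fin n → Carrier
        atE : Fin m → Carrier → Carrier

    LinearOn : FunΓ → Fin m → Carrier → Carrier → ℤ → Set
    LinearOn f e a b s =
      ∀ t → a ≤ t → t ≤ b → FunΓ.atE f e t ≡ FunΓ.atE f e a + (s · (t - a))

    data PLFrom (f : FunΓ) (e : Fin m) : Carrier → Carrier → Set where
      one  : ∀ {a b} (s : ℤ) → a < b → LinearOn f e a b s → PLFrom f e a b
      more : ∀ {a c b} (s : ℤ) → a < c → LinearOn f e a c s →
             PLFrom f e c b → PLFrom f e a b

    -- rational function: continuous (edge functions take the vertex values
    -- at the endpoints) and piecewise linear with integer slopes and finitely
    -- many pieces on each edge
    IsRational : FunΓ → Set
    IsRational f = ∀ e → (FunΓ.atE f e 0# ≡ FunΓ.atV f (src e))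
                       × (FunΓ.atE f e (len e) ≡ FunΓ.atV f (tgt e))
                       × PLFrom f e 0# (len e)

    SlopeOutSrc : FunΓ → Fin m → ℤ → Set
    SlopeOutSrc f e s = ∃[ ε ] (0# < ε × ∀ h → 0# ≤ h → h ≤ ε →
      FunΓ.atE f e h ≡ FunΓ.atE f e 0# + (s · h))
    SlopeOutTgt : FunΓ → Fin m → ℤ → Set
    SlopeOutTgt f e s = ∃[ ε ] (0# < ε × ∀ h → 0# ≤ h → h ≤ ε →
      FunΓ.atE f e (len e - h) ≡ FunΓ.atE f e (len e) + (s · h))
    SlopeRight : FunΓ → Fin m → Carrier → ℤ → Set
    SlopeRight f e t s = ∃[ ε ] (0# < ε × ∀ h → 0# ≤ h → h ≤ ε →
      FunΓ.atE f e (t + h) ≡ FunΓ.atE f e t + (s · h))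
    SlopeLeft : FunΓ → Fin m → Carrier → ℤ → Set
    SlopeLeft f e t s = ∃[ ε ] (0# < ε × ∀ h → 0# ≤ h → h ≤ ε →
      FunΓ.atE f e (t - h) ≡ FunΓ.atE f e t + (s · h))

    sumE : (Fin m → ℤ) → ℤ
    sumE g = go m (λ i → i) where
      open import Data.Fin using (fromℕ<; inject₁; toℕ)
      go : (k : ℕ) → (Fin k → Fin m) → ℤ
      go zeroℕ ι = ℤ.0ℤ
      go (sucℕ k) ι = g (ι Data.Fin.zero) ℤ.+ go k (λ i → ι (Data.Fin.suc i))

    open import Data.Fin using (_≟_)
    open import Relation.Nullary using (yes; no)

    [_≟_]⇒ : Fin n → Fin n → ℤ → ℤ
    [ u ≟ v ]⇒ z with u ≟ v
    ... | yes _ = z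
    ... | no  _ = ℤ.0ℤ

    -- ord_v(f) = k : sum of outgoing slopes over all edge-ends at v
    -- (a loop at v contributes both of its ends)
    OrdV : FunΓ → Fin n → ℤ → Set
    OrdV f v k = Σ (Fin m → ℤ) λ σ → Σ (Fin m → ℤ) λ τ →
      ((∀ e → SlopeOutSrc f e (σ e)) × (∀ e → SlopeOutTgt f e (τ e)) ×
       k ≡ sumE (λ e → [ src e ≟ v ]⇒ (σ e) ℤ.+ [ tgt e ≟ v ]⇒ (τ e)))

    OrdE : FunΓ → Fin m → Carrier → ℤ → Set
    OrdE f e t k = ∃[ r ] ∃[ l ] (SlopeRight f e t r × SlopeLeft f e t l × k ≡ r ℤ.+ l)

    PlusEffective : Divisor → FunΓ → Set
    PlusEffective D f =
        (∀ v k → OrdV f v k → ℤ.0ℤ ℤ.≤ Divisor.atV D v ℤ.+ k)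
      × (∀ e t → Interior e t → ∀ k → OrdE f e t k → ℤ.0ℤ ℤ.≤ Divisor.atE D e t ℤ.+ k)

    InR : Divisor → FunΓ → Set
    InR D f = IsRational f × PlusEffective D f

    PlusAnchor : Divisor → FunΓ → Set
    PlusAnchor D f = ∀ e t t' → Interior e t → Interior e t' →
      (∃[ k ] (OrdE f e t k × ℤ.0ℤ ℤ.< Divisor.atE D e t ℤ.+ k)) →
      (∃[ k ] (OrdE f e t' k × ℤ.0ℤ ℤ.< Divisor.atE D e t' ℤ.+ k)) →
      t ≡ t'

    AtMostTwoPieces : FunΓ → Fin m → Set
    AtMostTwoPieces f e = ∃[ c ] ∃[ s₁ ] ∃[ s₂ ]
      (Interior e c × LinearOn f e 0# c s₁ × LinearOn f e c (len e) s₂)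

-- At an interior point x of an edge a vertex-supported divisor D vanishes, so
-- (D + (f))(x) = ord_x f, the sum of the two outgoing slopes of f at x.  This is
-- nonnegative because D + (f) is effective, and nonzero exactly when the slope of
-- f changes at x.  Hence every breakpoint of f inside an edge is a point where
-- D + (f) is positive, and the anchor condition allows at most one such point.

module Submission where

open import Defs
open import Data.Nat using () renaming (suc to sucℕ; zero to zeroℕ)
open import Data.Integer as ℤ using (ℤ; -[1+_])
import Data.Integer.Properties as ℤP
open import Data.Fin using (Fin)
open import Data.Product using (∃-syntax; _×_; _,_; proj₁; proj₂)
open import Data.Sum using (_⊎_; inj₁; inj₂)
open import Data.Empty using (⊥-elim)
open import Relation.Nullary using (yes; no)
open import Relation.Binary.PropositionalEquality

module RealFieldProperties (ℝ : RealField) where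
  open RealField ℝ
  open ≡-Reasoning

  +-identityʳ : ∀ x → x + 0# ≡ x
  +-identityʳ x = trans (+-comm x 0#) (+-identityˡ x)

  -‿inverseʳ : ∀ x → x + (- x) ≡ 0#
  -‿inverseʳ x = trans (+-comm x (- x)) (-‿inverseˡ x)

  *-identityʳ : ∀ x → x * 1# ≡ x
  *-identityʳ x = trans (*-comm x 1#) (*-identityˡ x)

  distribˡ : ∀ x y z → x * (y + z) ≡ x * y + x * z
  distribˡ x y z = begin
    x * (y + z)     ≡⟨ *-comm x _ ⟩
    (y + z) * x     ≡⟨ distribʳ y z x ⟩
    y * x + z * x   ≡⟨ cong₂ _+_ (*-comm y x) (*-comm z x) ⟩
    x * y + x * z   ∎

  +-cancelʳ : ∀ x y z → x + z ≡ y + z → x ≡ y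
  +-cancelʳ x y z p = begin
    x                ≡⟨ sym (+-identityʳ x) ⟩
    x + 0#           ≡⟨ cong (x +_) (sym (-‿inverseʳ z)) ⟩
    x + (z - z)      ≡⟨ sym (+-assoc x z (- z)) ⟩
    (x + z) - z      ≡⟨ cong (_- z) p ⟩
    (y + z) - z      ≡⟨ +-assoc y z (- z) ⟩
    y + (z - z)      ≡⟨ cong (y +_) (-‿inverseʳ z) ⟩
    y + 0#           ≡⟨ +-identityʳ y ⟩
    y                ∎

  -‿unique : ∀ x y → x + y ≡ 0# → x ≡ - y
  -‿unique x y p = +-cancelʳ x (- y) y (trans p (sym (-‿inverseˡ y)))

  -‿involutive : ∀ x → - (- x) ≡ x
  -‿involutive x = sym (-‿unique x (- x) (-‿inverseʳ x))

  -0#≡0# : - 0# ≡ 0#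
  -0#≡0# = trans (sym (+-identityʳ (- 0#))) (-‿inverseˡ 0#)

  zeroˡ : ∀ x → 0# * x ≡ 0#
  zeroˡ x = +-cancelʳ _ _ (0# * x) (begin
    0# * x + 0# * x  ≡⟨ sym (distribʳ 0# 0# x) ⟩
    (0# + 0#) * x    ≡⟨ cong (_* x) (+-identityˡ 0#) ⟩
    0# * x           ≡⟨ sym (+-identityˡ _) ⟩
    0# + 0# * x      ∎)

  -‿distribˡ-* : ∀ x y → (- x) * y ≡ - (x * y)
  -‿distribˡ-* x y = -‿unique _ _ (begin
    (- x) * y + x * y  ≡⟨ sym (distribʳ (- x) x y) ⟩
    (- x + x) * y      ≡⟨ cong (_* y) (-‿inverseˡ x) ⟩
    0# * y             ≡⟨ zeroˡ y ⟩
    0#                 ∎)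

  -‿distribʳ-* : ∀ x y → x * (- y) ≡ - (x * y)
  -‿distribʳ-* x y = begin
    x * (- y)    ≡⟨ *-comm x (- y) ⟩
    (- y) * x    ≡⟨ -‿distribˡ-* y x ⟩
    - (y * x)    ≡⟨ cong -_ (*-comm y x) ⟩
    - (x * y)    ∎

  fromℤ-neg : ∀ s → fromℤ (ℤ.- s) ≡ - fromℤ s
  fromℤ-neg (ℤ.+ zeroℕ)= sym -0#≡0#
  fromℤ-neg (ℤ.+ sucℕ _)= refl
  fromℤ-neg -[1+ _ ]   = sym (-‿involutive _)

  neg-·≡·-neg : ∀ s x → (ℤ.- s) · x ≡ s · (- x)
  neg-·≡·-neg s x = begin
    fromℤ (ℤ.- s) * x   ≡⟨ cong (_* x) (fromℤ-neg s) ⟩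
    (- fromℤ s) * x     ≡⟨ -‿distribˡ-* (fromℤ s) x ⟩
    - (fromℤ s * x)     ≡⟨ sym (-‿distribʳ-* (fromℤ s) x) ⟩
    fromℤ s * (- x)     ∎

  x+[y-x]≡y : ∀ x y → x + (y - x) ≡ y
  x+[y-x]≡y x y = begin
    x + (y - x)     ≡⟨ cong (x +_) (+-comm y (- x)) ⟩
    x + (- x + y)   ≡⟨ sym (+-assoc x (- x) y) ⟩
    (x - x) + y     ≡⟨ cong (_+ y) (-‿inverseʳ x) ⟩
    0# + y          ≡⟨ +-identityˡ y ⟩
    y               ∎

  [x-y]+y≡x : ∀ x y → (x - y) + y ≡ x
  [x-y]+y≡x x y = begin
    (x - y) + y     ≡⟨ +-assoc x (- y) y ⟩
    x + (- y + y)   ≡⟨ cong (x +_) (-‿inverseˡ y) ⟩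
    x + 0#          ≡⟨ +-identityʳ x ⟩
    x               ∎

  [x+y]-y≡x : ∀ x y → (x + y) - y ≡ x
  [x+y]-y≡x x y = begin
    (x + y) - y     ≡⟨ +-assoc x y (- y) ⟩
    x + (y - y)     ≡⟨ cong (x +_) (-‿inverseʳ y) ⟩
    x + 0#          ≡⟨ +-identityʳ x ⟩
    x               ∎

  [x-y]-x≡-y : ∀ x y → (x - y) - x ≡ - y
  [x-y]-x≡-y x y = trans (cong (_- x) (+-comm x (- y))) ([x+y]-y≡x (- y) x)

  [y-x]+[z-y]≡z-x : ∀ x y z → (y - x) + (z - y) ≡ z - x
  [y-x]+[z-y]≡z-x x y z = begin
    (y - x) + (z - y)    ≡⟨ cong (_+ (z - y)) (+-comm y (- x)) ⟩
    (- x + y) + (z - y)  ≡⟨ +-assoc (- x) y _ ⟩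
    - x + (y + (z - y))  ≡⟨ cong (- x +_) (x+[y-x]≡y y z) ⟩
    - x + z              ≡⟨ +-comm (- x) z ⟩
    z - x                ∎

  affine-telescope : ∀ a k x y z → (a + k * (y - x)) + k * (z - y) ≡ a + k * (z - x)
  affine-telescope a k x y z = begin
    (a + k * (y - x)) + k * (z - y)  ≡⟨ +-assoc a _ _ ⟩
    a + (k * (y - x) + k * (z - y))  ≡⟨ cong (a +_) (sym (distribˡ k _ _)) ⟩
    a + k * ((y - x) + (z - y))      ≡⟨ cong (λ w → a + k * w) ([y-x]+[z-y]≡z-x x y z) ⟩
    a + k * (z - x)                  ∎

  ≤-trans : ∀ {x y z} → x ≤ y → y ≤ z → x ≤ z
  ≤-trans (inj₁ p) (inj₁ q)    = inj₁ (<-trans p q)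
  ≤-trans (inj₁ p) (inj₂ refl) = inj₁ p
  ≤-trans (inj₂ refl) q        = q

  ≤-<-trans : ∀ {x y z} → x ≤ y → y < z → x < z
  ≤-<-trans (inj₁ p) q    = <-trans p q
  ≤-<-trans (inj₂ refl) q = q

  +-monoˡ-≤ : ∀ {x y} z → x ≤ y → x + z ≤ y + z
  +-monoˡ-≤ z (inj₁ p)    = inj₁ (+-mono-< z p)
  +-monoˡ-≤ z (inj₂ refl) = inj₂ refl

  0≤y⇒x≤x+y : ∀ x y → 0# ≤ y → x ≤ x + y
  0≤y⇒x≤x+y x y p = subst₂ _≤_ (+-identityˡ x) (+-comm y x) (+-monoˡ-≤ x p)

  0≤y⇒x-y≤x : ∀ x y → 0# ≤ y → x - y ≤ x
  0≤y⇒x-y≤x x y p = subst₂ _≤_ (+-identityˡ _) (x+[y-x]≡y y x) (+-monoˡ-≤ (x - y) p)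

  y≤z-x⇒x+y≤z : ∀ x y z → y ≤ z - x → x + y ≤ z
  y≤z-x⇒x+y≤z x y z p = subst₂ _≤_ (+-comm y x) ([x-y]+y≡x z x) (+-monoˡ-≤ x p)

  y≤z-x⇒x≤z-y : ∀ x y z → y ≤ z - x → x ≤ z - y
  y≤z-x⇒x≤z-y x y z p = subst₂ _≤_ (x+[y-x]≡y y x) z-x+[x-y]≡z-y (+-monoˡ-≤ (x - y) p)
    where
    z-x+[x-y]≡z-y : (z - x) + (x - y) ≡ z - y
    z-x+[x-y]≡z-y = trans (+-comm (z - x) (x - y)) ([y-x]+[z-y]≡z-x y x z)

  x<y⇒0<y-x : ∀ x y → x < y → 0# < y - x
  x<y⇒0<y-x x y p = subst (_< y - x) (-‿inverseʳ x) (+-mono-< (- x) p)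

  x<0⇒0<-x : ∀ {x} → x < 0# → 0# < - x
  x<0⇒0<-x {x} p = subst₂ _<_ (-‿inverseʳ x) (+-identityˡ _) (+-mono-< (- x) p)

  0<1 : 0# < 1#
  0<1 with <-trichotomy 0# 1#
  ... | inj₁ p        = p
  ... | inj₂ (inj₁ p) = ⊥-elim (0≢1 p)
  ... | inj₂ (inj₂ p) = ⊥-elim (<-irrefl 1# (<-trans p 0<[-1]*[-1]))
    where
    -- 1 = (-1)·(-1) is a product of two positives.
    0<[-1]*[-1] : 0# < 1#
    0<[-1]*[-1] = subst (0# <_) (trans (-‿distribˡ-* 1# (- 1#)) (trans (cong -_ (*-identityˡ _)) (-‿involutive 1#)))
                  (*-pos (x<0⇒0<-x p) (x<0⇒0<-x p))

  inverse-pos : ∀ {x y} → 0# < x → y * x ≡ 1# → 0# < y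
  inverse-pos {x} {y} 0<x yx≡1 with <-trichotomy 0# y
  ... | inj₁ p        = p
  ... | inj₂ (inj₁ p) = ⊥-elim (0≢1 (trans (sym (zeroˡ x)) (trans (cong (_* x) p) yx≡1)))
  ... | inj₂ (inj₂ p) = ⊥-elim (<-irrefl 0# (<-trans 0<1 1<0))
    where
    0<-1 : 0# < - 1#
    0<-1 = subst (0# <_) (trans (-‿distribˡ-* y x) (cong -_ yx≡1)) (*-pos (x<0⇒0<-x p) 0<x)
    1<0 : 1# < 0#
    1<0 = subst₂ _<_ (+-identityˡ 1#) (-‿inverseˡ 1#) (+-mono-< 1# 0<-1)

  ∃-between : ∀ b → 0# < b → ∃[ c ] (0# < c × c < b)
  ∃-between b 0<b = y * b , 0<b/2 , subst₂ _<_ (+-identityˡ _) b/2+b/2≡b (+-mono-< (y * b) 0<b/2)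
    where
    0<2 : 0# < 1# + 1#
    0<2 = <-trans 0<1 (subst (_< 1# + 1#) (+-identityˡ 1#) (+-mono-< 1# 0<1))
    2≢0 : 1# + 1# ≢ 0#
    2≢0 eq = <-irrefl 0# (subst (0# <_) eq 0<2)
    y : Carrier
    y = proj₁ (*-inverse (1# + 1#) 2≢0)
    y2≡1 : y * (1# + 1#) ≡ 1#
    y2≡1 = proj₂ (*-inverse (1# + 1#) 2≢0)
    0<b/2 : 0# < y * b
    0<b/2 = *-pos (inverse-pos 0<2 y2≡1) 0<b
    b/2+b/2≡b : y * b + y * b ≡ b
    b/2+b/2≡b = begin
      y * b + y * b            ≡⟨ sym (distribʳ y y b) ⟩
      (y + y) * b              ≡⟨ cong (λ w → (w + w) * b) (sym (*-identityʳ y)) ⟩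
      (y * 1# + y * 1#) * b    ≡⟨ cong (_* b) (sym (distribˡ y 1# 1#)) ⟩
      (y * (1# + 1#)) * b      ≡⟨ cong (_* b) y2≡1 ⟩
      1# * b                   ≡⟨ *-identityˡ b ⟩
      b                        ∎

module PiecewiseLinear (ℝ : RealField) (Γ : MetricGraph ℝ) (f : FunΓ ℝ Γ) where
  open RealField ℝ
  open RealFieldProperties ℝ
  open MetricGraph Γ
  open ≡-Reasoning

  private
    F : Fin m → Carrier → Carrier
    F = FunΓ.atE f

    Linear : Fin m → Carrier → Carrier → ℤ → Set
    Linear = LinearOn ℝ Γ f

  LinearOn-glue : ∀ {e a c b s} → a < c → Linear e a c s → Linear e c b s → Linear e a b s
  LinearOn-glue {e} {a} {c} {b} {s} a<c l₁ l₂ t a≤t t≤b with <-trichotomy t c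
  ... | inj₁ t<c        = l₁ t a≤t (inj₁ t<c)
  ... | inj₂ (inj₁ t≡c) = l₁ t a≤t (inj₂ t≡c)
  ... | inj₂ (inj₂ c<t) = begin
    F e t                                ≡⟨ l₂ t (inj₁ c<t) t≤b ⟩
    F e c + s · (t - c)                  ≡⟨ cong (_+ s · (t - c)) (l₁ c (inj₁ a<c) (inj₂ refl)) ⟩
    (F e a + s · (c - a)) + s · (t - c)  ≡⟨ affine-telescope (F e a) (fromℤ s) a c t ⟩
    F e a + s · (t - a)                  ∎

  LinearOn-shrinkʳ : ∀ {e a b c s} → c ≤ b → Linear e a b s → Linear e a c s
  LinearOn-shrinkʳ c≤b l t a≤t t≤c = l t a≤t (≤-trans t≤c c≤b)

  LinearOn-shrinkˡ : ∀ {e a b c s} → a ≤ c → Linear e a b s → Linear e c b s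
  LinearOn-shrinkˡ {e} {a} {b} {c} {s} a≤c l t c≤t t≤b = begin
    F e t                                ≡⟨ l t (≤-trans a≤c c≤t) t≤b ⟩
    F e a + s · (t - a)                  ≡⟨ sym (affine-telescope (F e a) (fromℤ s) a c t) ⟩
    (F e a + s · (c - a)) + s · (t - c)  ≡⟨ cong (_+ s · (t - c)) (sym (l c a≤c (≤-trans c≤t t≤b))) ⟩
    F e c + s · (t - c)                  ∎

  LinearOn-fromʳ : ∀ {e a b s t} → a ≤ t → t ≤ b → Linear e a b s → F e t ≡ F e b + s · (t - b)
  LinearOn-fromʳ {e} {a} {b} {s} {t} a≤t t≤b l = begin
    F e t                                ≡⟨ l t a≤t t≤b ⟩
    F e a + s · (t - a)                  ≡⟨ sym (affine-telescope (F e a) (fromℤ s) a b t) ⟩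
    (F e a + s · (b - a)) + s · (t - b)  ≡⟨ cong (_+ s · (t - b)) (sym (l b (≤-trans a≤t t≤b) (inj₂ refl))) ⟩
    F e b + s · (t - b)                  ∎

  LinearOn⇒SlopeRight : ∀ {e c d s} → c < d → Linear e c d s → SlopeRight ℝ Γ f e c s
  LinearOn⇒SlopeRight {e} {c} {d} {s} c<d l = d - c , x<y⇒0<y-x c d c<d , λ h 0≤h h≤d-c → begin
    F e (c + h)                ≡⟨ l (c + h) (0≤y⇒x≤x+y c h 0≤h) (y≤z-x⇒x+y≤z c h d h≤d-c) ⟩
    F e c + s · ((c + h) - c)  ≡⟨ cong (λ z → F e c + s · z) (trans (cong (_- c) (+-comm c h)) ([x+y]-y≡x h c)) ⟩
    F e c + s · h              ∎

  LinearOn⇒SlopeLeft : ∀ {e a c s} → a < c → Linear e a c s → SlopeLeft ℝ Γ f e c (ℤ.- s)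
  LinearOn⇒SlopeLeft {e} {a} {c} {s} a<c l = c - a , x<y⇒0<y-x a c a<c , λ h 0≤h h≤c-a → begin
    F e (c - h)                ≡⟨ LinearOn-fromʳ {s = s} (y≤z-x⇒x≤z-y a h c h≤c-a) (0≤y⇒x-y≤x c h 0≤h) l ⟩
    F e c + s · ((c - h) - c)  ≡⟨ cong (λ z → F e c + s · z) ([x-y]-x≡-y c h) ⟩
    F e c + s · (- h)          ≡⟨ cong (F e c +_) (sym (neg-·≡·-neg s h)) ⟩
    F e c + (ℤ.- s) · h        ∎

  OrdE-breakpoint : ∀ {e a c d s s′} → a < c → c < d → Linear e a c s → Linear e c d s′ →
                    OrdE ℝ Γ f e c (s′ ℤ.- s)
  OrdE-breakpoint {s = s} {s′} a<c c<d l₁ l₂ =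
    s′ , ℤ.- s , LinearOn⇒SlopeRight {s = s′} c<d l₂ , LinearOn⇒SlopeLeft {s = s} a<c l₁ , refl

  PLFrom⇒< : ∀ {e a b} → PLFrom ℝ Γ f e a b → a < b
  PLFrom⇒< (PLFrom.one _ a<b _)       = a<b
  PLFrom⇒< (PLFrom.more _ a<c _ rest) = <-trans a<c (PLFrom⇒< rest)

module AnchorDivisor (ℝ : RealField) (Γ : MetricGraph ℝ) (D : Divisor ℝ Γ) (f : FunΓ ℝ Γ)
  (vertexSupported : VertexSupported ℝ Γ D) (plusEffective : PlusEffective ℝ Γ D f)
  (plusAnchor : PlusAnchor ℝ Γ D f) where
  open RealField ℝ
  open RealFieldProperties ℝ
  open PiecewiseLinear ℝ Γ f
  open MetricGraph Γ

  private
    Linear : Fin m → Carrier → Carrier → ℤ → Set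
    Linear = LinearOn ℝ Γ f

  PositiveAt : Fin m → Carrier → Set
  PositiveAt e c = ∃[ k ] (OrdE ℝ Γ f e c k × ℤ.0ℤ ℤ.< Divisor.atE D e c ℤ.+ k)

  breakpoint-positive : ∀ {e a c d s s′} → a < c → c < d → Interior ℝ Γ e c →
    Linear e a c s → Linear e c d s′ → s ≢ s′ → PositiveAt e c
  breakpoint-positive {e} {a} {c} {d} {s} {s′} a<c c<d c-interior l₁ l₂ s≢s′ =
    s′ ℤ.- s , ord , subst (λ z → ℤ.0ℤ ℤ.< z ℤ.+ (s′ ℤ.- s)) (sym D[c]≡0) (ℤP.≤∧≢⇒< 0≤k 0≢k)
    where
    D[c]≡0 : Divisor.atE D e c ≡ ℤ.0ℤ
    D[c]≡0 = vertexSupported e c c-interior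
    ord : OrdE ℝ Γ f e c (s′ ℤ.- s)
    ord = OrdE-breakpoint {s = s} {s′} a<c c<d l₁ l₂
    0≤k : ℤ.0ℤ ℤ.≤ ℤ.0ℤ ℤ.+ (s′ ℤ.- s)
    0≤k = subst (λ z → ℤ.0ℤ ℤ.≤ z ℤ.+ (s′ ℤ.- s)) D[c]≡0 (proj₂ plusEffective e c c-interior _ ord)
    0≢k : ℤ.0ℤ ≢ ℤ.0ℤ ℤ.+ (s′ ℤ.- s)
    0≢k eq = s≢s′ (sym (ℤP.i-j≡0⇒i≡j s′ s (sym (trans eq (ℤP.+-identityˡ _)))))

  OneOrTwoPiecesFrom : Fin m → Carrier → Set
  OneOrTwoPiecesFrom e a = (∃[ s ] Linear e a (len e) s)
    ⊎ (∃[ c ] ∃[ s₁ ] ∃[ s₂ ] (a < c × c < len e × Linear e a c s₁ × Linear e c (len e) s₂ × PositiveAt e c))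

  PLFrom⇒OneOrTwoPiecesFrom : ∀ {e a} → 0# ≤ a → PLFrom ℝ Γ f e a (len e) → OneOrTwoPiecesFrom e a
  PLFrom⇒OneOrTwoPiecesFrom _ (PLFrom.one s _ l) = inj₁ (s , l)
  PLFrom⇒OneOrTwoPiecesFrom {e} 0≤a (PLFrom.more {c = c} s a<c l rest)
    with PLFrom⇒OneOrTwoPiecesFrom (inj₁ (≤-<-trans 0≤a a<c)) rest
  ... | inj₁ (s′ , l′) with s ℤP.≟ s′
  ...   | yes refl = inj₁ (s , LinearOn-glue {s = s} a<c l l′)
  ...   | no s≢s′  = inj₂ (c , s , s′ , a<c , c<len , l , l′ ,
                           breakpoint-positive a<c c<len (≤-<-trans 0≤a a<c , c<len) l l′ s≢s′)
    where
    c<len : c < len e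
    c<len = PLFrom⇒< rest
  PLFrom⇒OneOrTwoPiecesFrom {e} 0≤a (PLFrom.more {c = c} s a<c l rest)
    | inj₂ (c′ , s₁ , s₂ , c<c′ , c′<len , l₁ , l₂ , c′-positive) with s ℤP.≟ s₁
  ... | yes refl = inj₂ (c′ , s , s₂ , <-trans a<c c<c′ , c′<len , LinearOn-glue {s = s} a<c l l₁ , l₂ , c′-positive)
  ... | no s≢s₁  = ⊥-elim (<-irrefl c (subst (c <_) (sym c≡c′) c<c′))
    where
    -- A second breakpoint c before c′ would be another positive point of D + (f).
    0<c : 0# < c
    0<c = ≤-<-trans 0≤a a<c
    c<len : c < len e
    c<len = <-trans c<c′ c′<len
    c≡c′ : c ≡ c′
    c≡c′ = plusAnchor e c c′ (0<c , c<len) (<-trans 0<c c<c′ , c′<len)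
             (breakpoint-positive a<c c<c′ (0<c , c<len) l l₁ s≢s₁) c′-positive

  atMostTwoPieces : ∀ e → PLFrom ℝ Γ f e 0# (len e) → AtMostTwoPieces ℝ Γ f e
  atMostTwoPieces e pl with PLFrom⇒OneOrTwoPiecesFrom (inj₂ refl) pl
  ... | inj₂ (c , s₁ , s₂ , 0<c , c<len , l₁ , l₂ , _) = c , s₁ , s₂ , (0<c , c<len) , l₁ , l₂
  ... | inj₁ (s , l) with ∃-between (len e) (len-pos e)
  ...   | c , 0<c , c<len =
    c , s , s , (0<c , c<len) , LinearOn-shrinkʳ {s = s} (inj₁ c<len) l , LinearOn-shrinkˡ {s = s} (inj₁ 0<c) l

lemma2p15 : (ℝ : RealField) (Γ : MetricGraph ℝ) → Connected ℝ Γ →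
    (D : Divisor ℝ Γ) → VertexSupported ℝ Γ D → Effective ℝ Γ D →
    (f : FunΓ ℝ Γ) → InR ℝ Γ D f → PlusAnchor ℝ Γ D f →
    ∀ e → AtMostTwoPieces ℝ Γ f e
lemma2p15 ℝ Γ _ D vertexSupported _ f (rational , plusEffective) plusAnchor e =
  AnchorDivisor.atMostTwoPieces ℝ Γ D f vertexSupported plusEffective plusAnchor e
    (proj₂ (proj₂ (rational e)))
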